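{- Let $m$ and $n$ be positive integers with $n$ odd, and let $q=2^m$. Let $L(x)=\sum_{i=0}^{m-1}a_ix^{2^i}$ with $a_i\in\mathbb{F}_q$ be a linearized polynomial over $\mathbb{F}_q$ such that $xL(x)+vx$ is a complete permutation polynomial over $\mathbb{F}_q$ for some $v\in\mathbb{F}_q\setminus\{0,1\}$. Then for every $u\in\mathbb{F}_q$, the polynomial \[F(x)=x\left(L(\mathrm{tr}(x))+u\,\mathrm{tr}(x)+ux\right)+vx\] is a complete permutation polynomial over $\mathbb{F}_{q^n}$.
   Context: A polynomial $f\in\mathbb{F}_Q[x]$ is a permutation polynomial over $\mathbb{F}_Q$ if it induces a bijection of $\mathbb{F}_Q$; it is a complete permutation polynomial over $\mathbb{F}_Q$ if both $f(x)$ and $f(x)+x$ are permutation polynomials over $\mathbb{F}_Q$. Here $\mathrm{tr}$ denotes the relative trace from $\mathbb{F}_{q^n}$ to $\mathbb{F}_q$, $\mathrm{tr}(x)=\sum_{i=0}^{n-1}x^{q^i}$. -}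

module Defs where

open import Level using (_⊔_)
open import Data.Nat using (ℕ; zero; suc; _^_)
open import Data.Fin using (Fin; toℕ) renaming (zero to fzero; suc to fsuc)
open import Data.Product using (∃; _×_; _,_)
open import Relation.Nullary using (¬_)
open import Function.Bundles using (Inverse)
open import Algebra.Bundles using (CommutativeRing)
import Relation.Binary.PropositionalEquality as ≡

module FF {c ℓ} (K : CommutativeRing c ℓ) where
  open CommutativeRing K

  record IsFieldOfOrder (N : ℕ) : Set (c ⊔ ℓ) where
    field
      0≉1     : ¬ (0# ≈ 1#)
      inverse : ∀ x → ¬ (x ≈ 0#) → ∃ λ y → x * y ≈ 1#
      card    : Inverse setoid (≡.setoid (Fin N))

  pow : Carrier → ℕ → Carrier
  pow x zero    = 1#
  pow x (suc k) = x * pow x k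

  Σ : (k : ℕ) → (Fin k → Carrier) → Carrier
  Σ zero    f = 0#
  Σ (suc k) f = f fzero + Σ k (λ i → f (fsuc i))

  -- membership in the subfield F_q = { x | x^q = x }
  InSub : ℕ → Carrier → Set ℓ
  InSub q x = pow x q ≈ x

  Lin : (m : ℕ) → (Fin m → Carrier) → Carrier → Carrier
  Lin m a y = Σ m (λ i → a i * pow y (2 ^ toℕ i))

  tr : (n q : ℕ) → Carrier → Carrier
  tr n q x = Σ n (λ i → pow x (q ^ toℕ i))

  PermOn : ∀ {p} → (Carrier → Set p) → (Carrier → Carrier) → Set (c ⊔ ℓ ⊔ p)
  PermOn P f =
    (∀ x → P x → P (f x)) ×
    (∀ x y → P x → P y → f x ≈ f y → x ≈ y) ×
    (∀ y → P y → ∃ λ x → P x × f x ≈ y)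

  CPPOn : ∀ {p} → (Carrier → Set p) → (Carrier → Carrier) → Set (c ⊔ ℓ ⊔ p)
  CPPOn P f = PermOn P f × PermOn P (λ x → f x + x)

{-# OPTIONS --safe #-}

-- Write T for the trace, G_w x = x (L (T x) + u T x + u x) + w x and g_w t = t L(t) + w t, so
-- that F = G_v and F + id = G_(v+1), while g_v and g_v + id = g_(v+1) are injective on F_q by
-- hypothesis. As T is F_q-linear and T(x²) = T(x)² in characteristic 2, T ∘ G_w = g_w ∘ T.
-- Hence G_w x = G_w y forces T x = T y = t, and then (x + y)(c + u (x + y)) = 0 with
-- c = L(t) + u t + w in F_q. If x ≠ y, either u = 0, so c = 0, g_w t = 0 = g_w 0, t = 0 and
-- w = 0; or u ≠ 0, so x + y = c/u lies in F_q and x + y = T(x + y) = 2t = 0 since n is odd.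
-- So G_v and G_(v+1) are injective, hence bijective on the finite field. Characteristic 2 and
-- x^(q^n) = x come from Fermat's little theorem, proved by comparing products over all elements.

module Submission where

open import Defs
open import Level using (Level; _⊔_)
open import Data.Nat using (ℕ; zero; suc; _^_; _≤_; NonZero) renaming (_+_ to _+ℕ_; _*_ to _*ℕ_)
import Data.Nat.Properties as ℕ
open import Data.Nat.Divisibility using (_∣_; divides; ∣m⇒∣m*n; m∣m*n)
open import Data.Fin using (Fin; toℕ; inject₁; fromℕ; punchOut) renaming (zero to fzero; suc to fsuc)
import Data.Fin.Properties as Fin
open import Data.Fin.Permutation using (Permutation; permutation)
open import Data.Vec.Functional using (removeAt)
open import Data.Product using (∃; _,_; proj₁; proj₂; map)
open import Data.Unit.Polymorphic using (⊤; tt)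
open import Data.Empty using (⊥-elim)
open import Function using (_∘_; id)
open import Function.Definitions using (Injective)
open import Function.Bundles using (Inverse; Injection)
open import Function.Properties.Inverse using (Inverse⇒Injection)
open import Relation.Nullary using (¬_; Dec; yes; no)
open import Relation.Nullary.Decidable using (map′)
open import Relation.Binary.PropositionalEquality using (_≡_; _≢_)
import Relation.Binary.PropositionalEquality as ≡
open import Algebra.Bundles using (CommutativeRing)
import Algebra.Properties.CommutativeMonoid.Sum

Fin-injective⇒surjective : ∀ {n} {h : Fin n → Fin n} → Injective _≡_ _≡_ h →
                           ∀ j → ∃ λ i → h i ≡ j
Fin-injective⇒surjective {suc n} {h} h-inj j with Fin.any? (λ i → h i Fin.≟ j)
... | yes hit = hit
... | no miss = ⊥-elim (Fin.<⇒notInjective (ℕ.n<1+n n) avoid-injective)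
  where
  avoid : Fin (suc n) → Fin n
  avoid i = punchOut {i = j} {j = h i} (λ j≡hi → miss (i , ≡.sym j≡hi))
  avoid-injective : Injective _≡_ _≡_ avoid
  avoid-injective = h-inj ∘ Fin.punchOut-injective {i = j} _ _

module Properties {c ℓ} (K : CommutativeRing c ℓ) where
  open CommutativeRing K
  open FF K
  open import Algebra.Properties.CommutativeSemiring.Exp commutativeSemiring
    renaming (_^_ to _^ᴷ_)
  open import Algebra.Properties.Semiring.Sum semiring
  open import Algebra.Properties.Group +-group
    using (∙-cancelˡ; inverseʳ-unique; x∙y⁻¹≈ε⇒x≈y; ⁻¹-involutive)
  open import Algebra.Properties.Ring ring using (-1*x≈-x; x[y-z]≈xy-xz)
  open import Relation.Binary.Reasoning.Setoid setoid

  InjectiveOn : ∀ {p} → (Carrier → Set p) → (Carrier → Carrier) → Set (c ⊔ ℓ ⊔ p)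
  InjectiveOn P f = ∀ x y → P x → P y → f x ≈ f y → x ≈ y

  pow≡^ : ∀ x k → pow x k ≡ x ^ᴷ k
  pow≡^ x zero    = ≡.refl
  pow≡^ x (suc k) = ≡.cong (x *_) (pow≡^ x k)

  pow-congˡ : ∀ k {x y} → x ≈ y → pow x k ≈ pow y k
  pow-congˡ k {x} {y} rewrite pow≡^ x k | pow≡^ y k = ^-congˡ k

  pow-distrib-* : ∀ x y k → pow (x * y) k ≈ pow x k * pow y k
  pow-distrib-* x y k rewrite pow≡^ (x * y) k | pow≡^ x k | pow≡^ y k = ^-distrib-* x y k

  pow-assocʳ : ∀ x a b → pow (pow x a) b ≈ pow x (a *ℕ b)
  pow-assocʳ x a b rewrite pow≡^ (pow x a) b | pow≡^ x a | pow≡^ x (a *ℕ b) = ^-assocʳ x a b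

  pow-oneˡ : ∀ k → pow 1# k ≈ 1#
  pow-oneˡ zero    = refl
  pow-oneˡ (suc k) = trans (*-identityˡ _) (pow-oneˡ k)

  pow-zeroˡ : ∀ k .{{_ : NonZero k}} → pow 0# k ≈ 0#
  pow-zeroˡ (suc k) = zeroˡ _

  Σ≡sum : ∀ k (f : Fin k → Carrier) → Σ k f ≡ sum f
  Σ≡sum zero    f = ≡.refl
  Σ≡sum (suc k) f = ≡.cong (f fzero +_) (Σ≡sum k (λ i → f (fsuc i)))

  Σ-cong : ∀ k {f g : Fin k → Carrier} → (∀ i → f i ≈ g i) → Σ k f ≈ Σ k g
  Σ-cong k {f} {g} f≈g rewrite Σ≡sum k f | Σ≡sum k g = sum-cong-≋ f≈g

  Σ-distrib-+ : ∀ k (f g : Fin k → Carrier) → Σ k (λ i → f i + g i) ≈ Σ k f + Σ k g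
  Σ-distrib-+ k f g rewrite Σ≡sum k (λ i → f i + g i) | Σ≡sum k f | Σ≡sum k g = ∑-distrib-+ f g

  *-distribˡ-Σ : ∀ k x (f : Fin k → Carrier) → x * Σ k f ≈ Σ k (λ i → x * f i)
  *-distribˡ-Σ k x f rewrite Σ≡sum k f | Σ≡sum k (λ i → x * f i) = *-distribˡ-sum x f

  Σ-zero : ∀ k {f : Fin k → Carrier} → (∀ i → f i ≈ 0#) → Σ k f ≈ 0#
  Σ-zero k {f} f≈0 rewrite Σ≡sum k f = trans (sum-cong-≋ f≈0) (sum-replicate-zero k)

  Σ-rotate : ∀ n (g : ℕ → Carrier) → g n ≈ g 0 →
             Σ n (λ i → g (suc (toℕ i))) ≈ Σ n (λ i → g (toℕ i))
  Σ-rotate n g gn≈g0 = ∙-cancelˡ (g 0) _ _ (begin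
    g 0 + Σ n (λ i → g (suc (toℕ i)))             ≡⟨ Σ≡sum (suc n) (λ i → g (toℕ i)) ⟩
    ∑[ i < suc n ] g (toℕ i)                      ≈⟨ sum-init-last (λ i → g (toℕ i)) ⟩
    ∑[ i < n ] g (toℕ (inject₁ i)) + g (toℕ (fromℕ n))
      ≈⟨ +-cong (sum-cong-≋ {n} (λ i → reflexive (≡.cong g (Fin.toℕ-inject₁ i))))
                (trans (reflexive (≡.cong g (Fin.toℕ-fromℕ n))) gn≈g0) ⟩
    ∑[ i < n ] g (toℕ i) + g 0                    ≡⟨ ≡.cong (_+ g 0) (Σ≡sum n (λ i → g (toℕ i))) ⟨
    Σ n (λ i → g (toℕ i)) + g 0                   ≈⟨ +-comm _ _ ⟩
    g 0 + Σ n (λ i → g (toℕ i))                   ∎)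

  pow-two : ∀ x → pow x 2 ≈ x * x
  pow-two x = *-congˡ (*-identityʳ x)

  characteristic-two : ∀ {e} → 2 ∣ e → pow (- 1#) e ≈ - 1# → 1# + 1# ≈ 0#
  characteristic-two (divides M ≡.refl) [-1]^e≈-1 = begin
    1# + 1#    ≈⟨ +-congˡ -1≈1 ⟨
    1# + - 1#  ≈⟨ -‿inverseʳ 1# ⟩
    0#         ∎
    where
    -1≈1 : - 1# ≈ 1#
    -1≈1 = begin
      - 1#                   ≈⟨ [-1]^e≈-1 ⟨
      pow (- 1#) (M *ℕ 2)    ≡⟨ ≡.cong (pow (- 1#)) (ℕ.*-comm M 2) ⟩
      pow (- 1#) (2 *ℕ M)    ≈⟨ pow-assocʳ (- 1#) 2 M ⟨
      pow (pow (- 1#) 2) M   ≈⟨ pow-congˡ M (trans (pow-two (- 1#)) (-1*x≈-x (- 1#))) ⟩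
      pow (- (- 1#)) M       ≈⟨ pow-congˡ M (⁻¹-involutive 1#) ⟩
      pow 1# M               ≈⟨ pow-oneˡ M ⟩
      1#                     ∎

  Lin-cong : ∀ n a {y z} → y ≈ z → Lin n a y ≈ Lin n a z
  Lin-cong n a y≈z = Σ-cong n (λ i → *-congˡ (pow-congˡ (2 ^ toℕ i) y≈z))

  Lin-zero : ∀ n a → Lin n a 0# ≈ 0#
  Lin-zero n a = Σ-zero n (λ i → trans (*-congˡ (pow-zeroˡ (2 ^ toℕ i) {{ℕ.m^n≢0 2 (toℕ i)}})) (zeroʳ _))

  module CharacteristicTwo (1+1≈0 : 1# + 1# ≈ 0#) where
    open import Algebra.Solver.Ring.NaturalCoefficients.Default commutativeSemiring

    x+x≈0 : ∀ x → x + x ≈ 0#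
    x+x≈0 x = begin
      x + x            ≈⟨ +-cong (*-identityˡ x) (*-identityˡ x) ⟨
      1# * x + 1# * x  ≈⟨ distribʳ x 1# 1# ⟨
      (1# + 1#) * x    ≈⟨ *-congʳ 1+1≈0 ⟩
      0# * x           ≈⟨ zeroˡ x ⟩
      0#               ∎

    -x≈x : ∀ x → - x ≈ x
    -x≈x x = sym (inverseʳ-unique x x (x+x≈0 x))

    x+y≈0⇒x≈y : ∀ {x y} → x + y ≈ 0# → x ≈ y
    x+y≈0⇒x≈y {x} {y} x+y≈0 = x∙y⁻¹≈ε⇒x≈y x y (trans (+-congˡ (-x≈x y)) x+y≈0)

    x≈y⇒x+y≈0 : ∀ {x y} → x ≈ y → x + y ≈ 0#
    x≈y⇒x+y≈0 {y = y} x≈y = trans (+-congʳ x≈y) (x+x≈0 y)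

    square-+ : ∀ x y → pow (x + y) 2 ≈ pow x 2 + pow y 2
    square-+ x y = begin
      pow (x + y) 2                     ≈⟨ pow-two (x + y) ⟩
      (x + y) * (x + y)                 ≈⟨ solve 2 (λ x y → (x :+ y) :* (x :+ y) :=
                                             (x :* x :+ y :* y) :+ (x :* y :+ x :* y)) refl x y ⟩
      (x * x + y * y) + (x * y + x * y) ≈⟨ +-congˡ (x+x≈0 (x * y)) ⟩
      (x * x + y * y) + 0#              ≈⟨ +-identityʳ _ ⟩
      x * x + y * y                     ≈⟨ +-cong (pow-two x) (pow-two y) ⟨
      pow x 2 + pow y 2                 ∎

    frobenius-+ : ∀ k x y → pow (x + y) (2 ^ k) ≈ pow x (2 ^ k) + pow y (2 ^ k)
    frobenius-+ zero    x y = trans (*-identityʳ _) (+-cong (sym (*-identityʳ x)) (sym (*-identityʳ y)))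
    frobenius-+ (suc k) x y = begin
      pow (x + y) (2 ^ suc k)                           ≈⟨ pow-assocʳ (x + y) 2 (2 ^ k) ⟨
      pow (pow (x + y) 2) (2 ^ k)                       ≈⟨ pow-congˡ (2 ^ k) (square-+ x y) ⟩
      pow (pow x 2 + pow y 2) (2 ^ k)                   ≈⟨ frobenius-+ k (pow x 2) (pow y 2) ⟩
      pow (pow x 2) (2 ^ k) + pow (pow y 2) (2 ^ k)     ≈⟨ +-cong (pow-assocʳ x 2 (2 ^ k)) (pow-assocʳ y 2 (2 ^ k)) ⟩
      pow x (2 ^ suc k) + pow y (2 ^ suc k)             ∎

    frobenius-Σ : ∀ k n (f : Fin n → Carrier) → pow (Σ n f) (2 ^ k) ≈ Σ n (λ i → pow (f i) (2 ^ k))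
    frobenius-Σ k zero    f = pow-zeroˡ (2 ^ k) {{ℕ.m^n≢0 2 k}}
    frobenius-Σ k (suc n) f = trans (frobenius-+ k _ _) (+-congˡ (frobenius-Σ k n (λ i → f (fsuc i))))

    Σ-const-odd : ∀ k x → Σ (2 *ℕ k +ℕ 1) (λ _ → x) ≈ x
    Σ-const-odd zero    x = +-identityʳ x
    Σ-const-odd (suc k) x rewrite ℕ.+-suc k (k +ℕ 0) = begin
      x + (x + Σ (2 *ℕ k +ℕ 1) (λ _ → x))  ≈⟨ +-assoc x x _ ⟨
      (x + x) + Σ (2 *ℕ k +ℕ 1) (λ _ → x)  ≈⟨ +-congʳ (x+x≈0 x) ⟩
      0# + Σ (2 *ℕ k +ℕ 1) (λ _ → x)       ≈⟨ +-identityˡ _ ⟩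
      Σ (2 *ℕ k +ℕ 1) (λ _ → x)            ≈⟨ Σ-const-odd k x ⟩
      x                                    ∎

    module Subfield (m : ℕ) where
      q : ℕ
      q = 2 ^ m

      frobenius-q^i : ∀ i x y → pow (x + y) (q ^ i) ≈ pow x (q ^ i) + pow y (q ^ i)
      frobenius-q^i i x y rewrite ℕ.^-*-assoc 2 m i = frobenius-+ (m *ℕ i) x y

      InSub-cong : ∀ {x y} → x ≈ y → InSub q x → InSub q y
      InSub-cong x≈y x∈ = trans (pow-congˡ q (sym x≈y)) (trans x∈ x≈y)

      InSub-0 : InSub q 0#
      InSub-0 = pow-zeroˡ q {{ℕ.m^n≢0 2 m}}

      InSub-1 : InSub q 1#
      InSub-1 = pow-oneˡ q

      InSub-+ : ∀ {x y} → InSub q x → InSub q y → InSub q (x + y)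
      InSub-+ x∈ y∈ = trans (frobenius-+ m _ _) (+-cong x∈ y∈)

      InSub-* : ∀ {x y} → InSub q x → InSub q y → InSub q (x * y)
      InSub-* x∈ y∈ = trans (pow-distrib-* _ _ q) (*-cong x∈ y∈)

      InSub-pow : ∀ {x} k → InSub q x → InSub q (pow x k)
      InSub-pow {x} k x∈ = begin
        pow (pow x k) q  ≈⟨ pow-assocʳ x k q ⟩
        pow x (k *ℕ q)   ≡⟨ ≡.cong (pow x) (ℕ.*-comm k q) ⟩
        pow x (q *ℕ k)   ≈⟨ pow-assocʳ x q k ⟨
        pow (pow x q) k  ≈⟨ pow-congˡ k x∈ ⟩
        pow x k          ∎

      InSub-Σ : ∀ n {f : Fin n → Carrier} → (∀ i → InSub q (f i)) → InSub q (Σ n f)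
      InSub-Σ zero    f∈ = InSub-0
      InSub-Σ (suc n) f∈ = InSub-+ (f∈ fzero) (InSub-Σ n (f∈ ∘ fsuc))

      InSub-Lin : ∀ n {a} {y} → (∀ i → InSub q (a i)) → InSub q y → InSub q (Lin n a y)
      InSub-Lin n a∈ y∈ = InSub-Σ n (λ i → InSub-* (a∈ i) (InSub-pow (2 ^ toℕ i) y∈))

      InSub-inverse : ∀ {x y} → InSub q x → x * y ≈ 1# → InSub q y
      InSub-inverse {x} {y} x∈ xy≈1 = begin
        pow y q                   ≈⟨ *-identityʳ _ ⟨
        pow y q * 1#              ≈⟨ *-congˡ xy≈1 ⟨
        pow y q * (x * y)         ≈⟨ *-assoc _ x y ⟨
        (pow y q * x) * y         ≈⟨ *-congʳ (*-congˡ x∈) ⟨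
        (pow y q * pow x q) * y   ≈⟨ *-congʳ (pow-distrib-* y x q) ⟨
        pow (y * x) q * y         ≈⟨ *-congʳ (pow-congˡ q (trans (*-comm y x) xy≈1)) ⟩
        pow 1# q * y              ≈⟨ *-congʳ (pow-oneˡ q) ⟩
        1# * y                    ≈⟨ *-identityˡ y ⟩
        y                         ∎

      InSub-fixed : ∀ {x} → InSub q x → ∀ i → pow x (q ^ i) ≈ x
      InSub-fixed {x} x∈ zero    = *-identityʳ x
      InSub-fixed {x} x∈ (suc i) = begin
        pow x (q *ℕ q ^ i)       ≈⟨ pow-assocʳ x q (q ^ i) ⟨
        pow (pow x q) (q ^ i)    ≈⟨ pow-congˡ (q ^ i) x∈ ⟩
        pow x (q ^ i)            ≈⟨ InSub-fixed x∈ i ⟩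
        x                        ∎

      tr-cong : ∀ n {x y} → x ≈ y → tr n q x ≈ tr n q y
      tr-cong n x≈y = Σ-cong n (λ i → pow-congˡ (q ^ toℕ i) x≈y)

      tr-+ : ∀ n x y → tr n q (x + y) ≈ tr n q x + tr n q y
      tr-+ n x y = trans (Σ-cong n (λ i → frobenius-q^i (toℕ i) x y)) (Σ-distrib-+ n _ _)

      tr-*ˡ : ∀ n {c} x → InSub q c → tr n q (c * x) ≈ c * tr n q x
      tr-*ˡ n {c} x c∈ = begin
        tr n q (c * x)                                     ≈⟨ Σ-cong n (λ i → pow-distrib-* c x (q ^ toℕ i)) ⟩
        Σ n (λ i → pow c (q ^ toℕ i) * pow x (q ^ toℕ i))
          ≈⟨ Σ-cong n (λ i → *-congʳ (InSub-fixed c∈ (toℕ i))) ⟩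
        Σ n (λ i → c * pow x (q ^ toℕ i))                  ≈⟨ *-distribˡ-Σ n c _ ⟨
        c * tr n q x                                       ∎

      tr-square : ∀ n x → tr n q (x * x) ≈ tr n q x * tr n q x
      tr-square n x = begin
        tr n q (x * x)                                     ≈⟨ Σ-cong n (λ i → pow-distrib-* x x (q ^ toℕ i)) ⟩
        Σ n (λ i → pow x (q ^ toℕ i) * pow x (q ^ toℕ i)) ≈⟨ Σ-cong n (λ i → pow-two _) ⟨
        Σ n (λ i → pow (pow x (q ^ toℕ i)) 2)              ≈⟨ frobenius-Σ 1 n _ ⟨
        pow (tr n q x) 2                                   ≈⟨ pow-two _ ⟩
        tr n q x * tr n q x                                ∎

      tr-InSub : ∀ n → (∀ x → pow x (q ^ n) ≈ x) → ∀ x → InSub q (tr n q x)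
      tr-InSub n fermat x = begin
        pow (tr n q x) q                              ≈⟨ frobenius-Σ m n _ ⟩
        Σ n (λ i → pow (pow x (q ^ toℕ i)) q)         ≈⟨ Σ-cong n (λ i → pow-assocʳ x (q ^ toℕ i) q) ⟩
        Σ n (λ i → pow x (q ^ toℕ i *ℕ q))
          ≈⟨ Σ-cong n (λ i → reflexive (≡.cong (pow x) (ℕ.*-comm (q ^ toℕ i) q))) ⟩
        Σ n (λ i → pow x (q ^ suc (toℕ i)))
          ≈⟨ Σ-rotate n (λ j → pow x (q ^ j)) (trans (fermat x) (sym (*-identityʳ x))) ⟩
        tr n q x                                      ∎

      tr-odd : ∀ k {x} → InSub q x → tr (2 *ℕ k +ℕ 1) q x ≈ x
      tr-odd k x∈ = trans (Σ-cong (2 *ℕ k +ℕ 1) (λ i → InSub-fixed x∈ (toℕ i))) (Σ-const-odd k _)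

  module FiniteField {N} (isField : IsFieldOfOrder N) where
    open IsFieldOfOrder isField
    module ∏ = Algebra.Properties.CommutativeMonoid.Sum *-commutativeMonoid
    open Inverse card using (to; from; to-cong; strictlyInverseˡ; strictlyInverseʳ)
    open Injection (Inverse⇒Injection card) using () renaming (injective to to-injective)

    infix 4 _≟_
    _≟_ : ∀ x y → Dec (x ≈ y)
    x ≟ y = map′ to-injective to-cong (to x Fin.≟ to y)

    x≉0∧x*y≈0⇒y≈0 : ∀ {x y} → ¬ (x ≈ 0#) → x * y ≈ 0# → y ≈ 0#
    x≉0∧x*y≈0⇒y≈0 {x} {y} x≉0 x*y≈0 with inverse x x≉0
    ... | x⁻¹ , x*x⁻¹≈1 = begin
      y               ≈⟨ *-identityˡ y ⟨
      1# * y          ≈⟨ *-congʳ (trans (*-comm x⁻¹ x) x*x⁻¹≈1) ⟨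
      (x⁻¹ * x) * y   ≈⟨ *-assoc x⁻¹ x y ⟩
      x⁻¹ * (x * y)   ≈⟨ *-congˡ x*y≈0 ⟩
      x⁻¹ * 0#        ≈⟨ zeroʳ x⁻¹ ⟩
      0#              ∎

    x≉0∧y≉0⇒x*y≉0 : ∀ {x y} → ¬ (x ≈ 0#) → ¬ (y ≈ 0#) → ¬ (x * y ≈ 0#)
    x≉0∧y≉0⇒x*y≉0 x≉0 y≉0 x*y≈0 = y≉0 (x≉0∧x*y≈0⇒y≈0 x≉0 x*y≈0)

    *-cancelʳ-≉0 : ∀ {x y z} → ¬ (z ≈ 0#) → x * z ≈ y * z → x ≈ y
    *-cancelʳ-≉0 {x} {y} {z} z≉0 xz≈yz = x∙y⁻¹≈ε⇒x≈y x y (x≉0∧x*y≈0⇒y≈0 z≉0 (begin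
      z * (x - y)    ≈⟨ x[y-z]≈xy-xz z x y ⟩
      z * x - z * y  ≈⟨ +-congʳ (trans (*-comm z x) (trans xz≈yz (*-comm y z))) ⟩
      z * y - z * y  ≈⟨ -‿inverseʳ (z * y) ⟩
      0#             ∎))

    from-injective : Injective _≡_ _≈_ from
    from-injective {i} {j} from-i≈from-j =
      ≡.trans (≡.sym (strictlyInverseˡ i)) (≡.trans (to-cong from-i≈from-j) (strictlyInverseˡ j))

    injective⇒surjective : ∀ {f : Carrier → Carrier} → Injective _≈_ _≈_ f → ∀ y → ∃ λ x → f x ≈ y
    injective⇒surjective {f} f-inj y = map from to-injective (Fin-injective⇒surjective h-inj (to y))
      where
      h : Fin N → Fin N
      h i = to (f (from i))
      h-inj : Injective _≡_ _≡_ h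
      h-inj = from-injective ∘ f-inj ∘ to-injective

    -- Multiplication by a ≉ 0 permutes the elements; comparing the products of `nonzero` over all
    -- elements shows that the product of the `weight`s, which is a^(N-1), equals 1.
    nonzero : Carrier → Carrier
    nonzero x with x ≟ 0#
    ... | yes _ = 1#
    ... | no  _ = x

    weight : Carrier → Carrier → Carrier
    weight a x with x ≟ 0#
    ... | yes _ = 1#
    ... | no  _ = a

    nonzero-cong : ∀ {x y} → x ≈ y → nonzero x ≈ nonzero y
    nonzero-cong {x} {y} x≈y with x ≟ 0# | y ≟ 0#
    ... | yes _   | yes _   = refl
    ... | yes x≈0 | no  y≉0 = ⊥-elim (y≉0 (trans (sym x≈y) x≈0))
    ... | no  x≉0 | yes y≈0 = ⊥-elim (x≉0 (trans x≈y y≈0))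
    ... | no  _   | no  _   = x≈y

    nonzero≉0 : ∀ x → ¬ (nonzero x ≈ 0#)
    nonzero≉0 x with x ≟ 0#
    ... | yes _   = 0≉1 ∘ sym
    ... | no  x≉0 = x≉0

    nonzero-* : ∀ {a} x → ¬ (a ≈ 0#) → nonzero (a * x) ≈ weight a x * nonzero x
    nonzero-* {a} x a≉0 with a * x ≟ 0# | x ≟ 0#
    ... | yes _    | yes _   = sym (*-identityˡ 1#)
    ... | yes ax≈0 | no  x≉0 = ⊥-elim (x≉0∧y≉0⇒x*y≉0 a≉0 x≉0 ax≈0)
    ... | no  ax≉0 | yes x≈0 = ⊥-elim (ax≉0 (trans (*-congˡ x≈0) (zeroʳ a)))
    ... | no  _    | no  _   = refl

    weight-0 : ∀ a {x} → x ≈ 0# → weight a x ≈ 1#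
    weight-0 a {x} x≈0 with x ≟ 0#
    ... | yes _   = refl
    ... | no  x≉0 = ⊥-elim (x≉0 x≈0)

    weight-≉0 : ∀ a {x} → ¬ (x ≈ 0#) → weight a x ≈ a
    weight-≉0 a {x} x≉0 with x ≟ 0#
    ... | yes x≈0 = ⊥-elim (x≉0 x≈0)
    ... | no  _   = refl

    ∏-≉0 : ∀ {n} (f : Fin n → Carrier) → (∀ i → ¬ (f i ≈ 0#)) → ¬ (∏.sum f ≈ 0#)
    ∏-≉0 {zero}  f f≉0 = 0≉1 ∘ sym
    ∏-≉0 {suc n} f f≉0 = x≉0∧y≉0⇒x*y≉0 (f≉0 fzero) (∏-≉0 (f ∘ fsuc) (f≉0 ∘ fsuc))

    ∏-except-one : ∀ {n} a (f : Fin n → Carrier) j → f j ≈ 1# → (∀ i → i ≢ j → f i ≈ a) →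
                   ∏.sum f * a ≈ pow a n
    ∏-except-one {suc n} a f j fj≈1 fi≈a = begin
      ∏.sum f * a                            ≈⟨ *-congʳ (∏.sum-remove {i = j} f) ⟩
      (f j * ∏.sum (removeAt f j)) * a
        ≈⟨ *-congʳ (*-cong fj≈1 (∏.sum-cong-≋ {n} (λ i → fi≈a _ (Fin.punchInᵢ≢i j i)))) ⟩
      (1# * ∏.sum {n} (λ _ → a)) * a         ≈⟨ *-congʳ (trans (*-identityˡ _) (∏.sum-replicate n)) ⟩
      a ^ᴷ n * a                             ≡⟨ ≡.cong (_* a) (pow≡^ a n) ⟨
      pow a n * a                            ≈⟨ *-comm _ a ⟩
      pow a (suc n)                          ∎

    from≉0 : ∀ {i} → i ≢ to 0# → ¬ (from i ≈ 0#)
    from≉0 {i} i≢0 from-i≈0 = i≢0 (≡.trans (≡.sym (strictlyInverseˡ i)) (to-cong from-i≈0))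

    scaling : ∀ {a b} → a * b ≈ 1# → Permutation N N
    scaling {a} {b} ab≈1 = permutation (multiply a) (multiply b)
      (cancel ab≈1) (cancel (trans (*-comm b a) ab≈1))
      where
      multiply : Carrier → Fin N → Fin N
      multiply x i = to (x * from i)
      cancel : ∀ {x y} → x * y ≈ 1# → ∀ i → multiply x (multiply y i) ≡ i
      cancel {x} {y} xy≈1 i = ≡.trans (to-cong (begin
        x * from (to (y * from i))  ≈⟨ *-congˡ (strictlyInverseʳ _) ⟩
        x * (y * from i)            ≈⟨ *-assoc x y _ ⟨
        (x * y) * from i            ≈⟨ *-congʳ xy≈1 ⟩
        1# * from i                 ≈⟨ *-identityˡ _ ⟩
        from i                      ∎)) (strictlyInverseˡ i)

    fermat-≉0 : ∀ {a} → ¬ (a ≈ 0#) → pow a N ≈ a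
    fermat-≉0 {a} a≉0 with inverse a a≉0
    ... | b , ab≈1 = begin
      pow a N
        ≈⟨ ∏-except-one a W (to 0#) (weight-0 a (strictlyInverseʳ 0#)) (λ i → weight-≉0 a ∘ from≉0) ⟨
      ∏.sum W * a    ≈⟨ *-congʳ ∏W≈1 ⟩
      1# * a         ≈⟨ *-identityˡ a ⟩
      a              ∎
      where
      W U : Fin N → Carrier
      W i = weight a (from i)
      U i = nonzero (from i)
      ∏W≈1 : ∏.sum W ≈ 1#
      ∏W≈1 = *-cancelʳ-≉0 (∏-≉0 U (nonzero≉0 ∘ from)) (sym (begin
        1# * ∏.sum U                            ≈⟨ *-identityˡ _ ⟩
        ∏.sum U                                 ≈⟨ ∏.∑-permute U (scaling ab≈1) ⟩
        ∏.sum (λ i → U (to (a * from i)))       ≈⟨ ∏.sum-cong-≋ {N} (λ i → nonzero-cong (strictlyInverseʳ _)) ⟩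
        ∏.sum (λ i → nonzero (a * from i))      ≈⟨ ∏.sum-cong-≋ {N} (λ i → nonzero-* (from i) a≉0) ⟩
        ∏.sum (λ i → W i * U i)                 ≈⟨ ∏.∑-distrib-+ W U ⟩
        ∏.sum W * ∏.sum U                       ∎))

    fermat : ∀ a → pow a N ≈ a
    fermat a with a ≟ 0#
    ... | no  a≉0 = fermat-≉0 a≉0
    ... | yes a≈0 = begin
      pow a N   ≈⟨ pow-congˡ N a≈0 ⟩
      pow 0# N  ≈⟨ pow-zeroˡ N {{Fin.nonZeroIndex (to 0#)}} ⟩
      0#        ≈⟨ a≈0 ⟨
      a         ∎

    injective⇒PermOn : ∀ {p} {f : Carrier → Carrier} → Injective _≈_ _≈_ f → PermOn (λ _ → ⊤ {p}) f
    injective⇒PermOn f-inj =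
      (λ _ _ → tt) , (λ _ _ _ _ → f-inj) , (λ y _ → map id (tt ,_) (injective⇒surjective f-inj y))

2∣[2^m]^n : ∀ {m n} → 1 ≤ m → 1 ≤ n → 2 ∣ (2 ^ m) ^ n
2∣[2^m]^n {suc m} {suc n} _ _ = ∣m⇒∣m*n _ (m∣m*n (2 ^ m))

module TraceConstruction {r ℓ} (K : CommutativeRing r ℓ) (m k : ℕ) (1≤m : 1 ≤ m)
         (isField : FF.IsFieldOfOrder K ((2 ^ m) ^ (2 *ℕ k +ℕ 1))) where
  open CommutativeRing K
  open FF K
  open Properties K
  open FiniteField isField
  open IsFieldOfOrder isField using (inverse)
  open import Algebra.Solver.Ring.NaturalCoefficients.Default commutativeSemiring
  open import Relation.Binary.Reasoning.Setoid setoid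

  n : ℕ
  n = 2 *ℕ k +ℕ 1

  1+1≈0 : 1# + 1# ≈ 0#
  1+1≈0 = characteristic-two (2∣[2^m]^n 1≤m (ℕ.m≤n+m 1 (2 *ℕ k))) (fermat (- 1#))

  open CharacteristicTwo 1+1≈0
  open Subfield m

  T : Carrier → Carrier
  T = tr n q

  T∈ : ∀ x → InSub q (T x)
  T∈ = tr-InSub n fermat

  G : (Carrier → Carrier) → Carrier → Carrier → Carrier → Carrier
  G L u w x = x * (L (T x) + u * T x + u * x) + w * x

  g : (Carrier → Carrier) → Carrier → Carrier → Carrier
  g L w t = t * L t + w * t

  module _ (L : Carrier → Carrier) (L-cong : ∀ {s t} → s ≈ t → L s ≈ L t)
           (L-InSub : ∀ {t} → InSub q t → InSub q (L t)) (L-zero : L 0# ≈ 0#)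
           {u : Carrier} (u∈ : InSub q u) where

    T-G : ∀ {w} → InSub q w → ∀ x → T (G L u w x) ≈ g L w (T x)
    T-G {w} w∈ x = begin
      T (G L u w x)                      ≈⟨ tr-cong n (solve 5 (λ x l t u w →
                                              x :* (l :+ u :* t :+ u :* x) :+ w :* x :=
                                              (l :+ u :* t :+ w) :* x :+ u :* (x :* x)) refl x l t u w) ⟩
      T (c * x + u * (x * x))            ≈⟨ tr-+ n _ _ ⟩
      T (c * x) + T (u * (x * x))        ≈⟨ +-cong (tr-*ˡ n x c∈)
                                                   (trans (tr-*ˡ n (x * x) u∈) (*-congˡ (tr-square n x))) ⟩
      c * t + u * (t * t)                ≈⟨ solve 4 (λ l t u w →
                                              (l :+ u :* t :+ w) :* t :+ u :* (t :* t) :=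
                                              (t :* l :+ w :* t) :+ (u :* t :* t :+ u :* t :* t)) refl l t u w ⟩
      g L w t + (u * t * t + u * t * t)  ≈⟨ +-congˡ (x+x≈0 _) ⟩
      g L w t + 0#                       ≈⟨ +-identityʳ _ ⟩
      g L w t                            ∎
      where
      t = T x
      l = L t
      c = l + u * t + w
      c∈ : InSub q c
      c∈ = InSub-+ (InSub-+ (L-InSub (T∈ x)) (InSub-* u∈ (T∈ x))) w∈

    module Collision {w} (w∈ : InSub q w) (g-inj : InjectiveOn (InSub q) (g L w))
                     {x y} (Gx≈Gy : G L u w x ≈ G L u w y) where
      t l c : Carrier
      t = T x
      l = L t
      c = l + u * t + w

      Tx≈Ty : T x ≈ T y
      Tx≈Ty = g-inj _ _ (T∈ x) (T∈ y) (trans (sym (T-G w∈ x)) (trans (tr-cong n Gx≈Gy) (T-G w∈ y)))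

      factorisation : (x + y) * (c + u * (x + y)) ≈ 0#
      factorisation = begin
        (x + y) * (c + u * (x + y))             ≈⟨ solve 6 (λ x y l t u w →
            (x :+ y) :* (l :+ u :* t :+ w :+ u :* (x :+ y)) :=
            (x :* (l :+ u :* t :+ u :* x) :+ w :* x) :+ (y :* (l :+ u :* t :+ u :* y) :+ w :* y)
              :+ u :* (x :* y :+ x :* y)) refl x y l t u w ⟩
        (G L u w x + Gy) + u * (x * y + x * y)  ≈⟨ +-cong (x≈y⇒x+y≈0 (trans Gx≈Gy Gy-via-Tx))
                                                            (*-congˡ (x+x≈0 _)) ⟩
        0# + u * 0#                             ≈⟨ trans (+-identityˡ _) (zeroʳ u) ⟩
        0#                                      ∎
        where
        Gy = y * (l + u * t + u * y) + w * y
        Gy-via-Tx : G L u w y ≈ Gy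
        Gy-via-Tx = +-congʳ (*-congˡ (+-congʳ (+-cong (L-cong (sym Tx≈Ty)) (*-congˡ (sym Tx≈Ty)))))

      c≈u[x+y] : ¬ (x + y ≈ 0#) → c ≈ u * (x + y)
      c≈u[x+y] x+y≉0 = x+y≈0⇒x≈y (x≉0∧x*y≈0⇒y≈0 x+y≉0 factorisation)

      u≈0⇒w≈0 : ¬ (x + y ≈ 0#) → u ≈ 0# → w ≈ 0#
      u≈0⇒w≈0 x+y≉0 u≈0 = begin
        w           ≈⟨ +-identityˡ w ⟨
        0# + w      ≈⟨ +-congʳ (trans (L-cong t≈0) L-zero) ⟨
        l + w       ≈⟨ l+w≈0 ⟩
        0#          ∎
        where
        l+w≈0 : l + w ≈ 0#
        l+w≈0 = begin
          l + w            ≈⟨ +-congʳ (trans (+-congˡ (trans (*-congʳ u≈0) (zeroˡ t))) (+-identityʳ l)) ⟨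
          l + u * t + w    ≈⟨ c≈u[x+y] x+y≉0 ⟩
          u * (x + y)      ≈⟨ trans (*-congʳ u≈0) (zeroˡ _) ⟩
          0#               ∎
        t≈0 : t ≈ 0#
        t≈0 = g-inj t 0# (T∈ x) InSub-0 (begin
          t * l + w * t    ≈⟨ +-congˡ (*-comm w t) ⟩
          t * l + t * w    ≈⟨ distribˡ t l w ⟨
          t * (l + w)      ≈⟨ *-congˡ l+w≈0 ⟩
          t * 0#           ≈⟨ zeroʳ t ⟩
          0#               ≈⟨ trans (+-cong (zeroˡ _) (zeroʳ w)) (+-identityˡ 0#) ⟨
          0# * L 0# + w * 0# ∎)

      u≉0⇒x+y≈0 : ¬ (x + y ≈ 0#) → ¬ (u ≈ 0#) → x + y ≈ 0#
      u≉0⇒x+y≈0 x+y≉0 u≉0 with inverse u u≉0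
      ... | u⁻¹ , uu⁻¹≈1 = begin
        x + y            ≈⟨ tr-odd k x+y∈ ⟨
        T (x + y)        ≈⟨ tr-+ n x y ⟩
        T x + T y        ≈⟨ x≈y⇒x+y≈0 Tx≈Ty ⟩
        0#               ∎
        where
        x+y≈u⁻¹c : x + y ≈ u⁻¹ * c
        x+y≈u⁻¹c = begin
          x + y               ≈⟨ *-identityˡ _ ⟨
          1# * (x + y)        ≈⟨ *-congʳ (trans (*-comm u⁻¹ u) uu⁻¹≈1) ⟨
          u⁻¹ * u * (x + y)   ≈⟨ *-assoc u⁻¹ u _ ⟩
          u⁻¹ * (u * (x + y)) ≈⟨ *-congˡ (c≈u[x+y] x+y≉0) ⟨
          u⁻¹ * c             ∎
        x+y∈ : InSub q (x + y)
        x+y∈ = InSub-cong (sym x+y≈u⁻¹c) (InSub-* (InSub-inverse u∈ uu⁻¹≈1)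
                 (InSub-+ (InSub-+ (L-InSub (T∈ x)) (InSub-* u∈ (T∈ x))) w∈))

    G-injective : ∀ {w} → InSub q w → ¬ (w ≈ 0#) → InjectiveOn (InSub q) (g L w) →
                  Injective _≈_ _≈_ (G L u w)
    G-injective {w} w∈ w≉0 g-inj {x} {y} Gx≈Gy with x + y ≟ 0# | u ≟ 0#
    ... | yes x+y≈0 | _       = x+y≈0⇒x≈y x+y≈0
    ... | no  x+y≉0 | yes u≈0 = ⊥-elim (w≉0 (Collision.u≈0⇒w≈0 w∈ g-inj Gx≈Gy x+y≉0 u≈0))
    ... | no  x+y≉0 | no  u≉0 = ⊥-elim (x+y≉0 (Collision.u≉0⇒x+y≈0 w∈ g-inj Gx≈Gy x+y≉0 u≉0))

theorem3 : ∀ {c ℓ : Level} (m n : ℕ) → 1 ≤ m → (∃ λ k → n ≡ 2 *ℕ k +ℕ 1) →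
    (K : CommutativeRing c ℓ) → FF.IsFieldOfOrder K ((2 ^ m) ^ n) →
    let open CommutativeRing K
        open FF K
        q = 2 ^ m
    in (a : Fin m → Carrier) → (∀ i → InSub q (a i)) →
       (v : Carrier) → InSub q v → ¬ (v ≈ 0#) → ¬ (v ≈ 1#) →
       CPPOn (InSub q) (λ x → x * Lin m a x + v * x) →
       (u : Carrier) → InSub q u →
       CPPOn (λ _ → ⊤ {ℓ}) (λ x → x * (Lin m a (tr n q x) + u * tr n q x + u * x) + v * x)
theorem3 m n 1≤m (k , ≡.refl) K isField a a∈ v v∈ v≉0 v≉1 (g-perm , g+id-perm) u u∈ =
  injective⇒PermOn (G-Lin-injective v∈ v≉0 (proj₁ (proj₂ g-perm))) ,
  injective⇒PermOn (λ {x} {y} e → G-Lin-injective v+1∈ v+1≉0 g+id-inj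
    (trans (shift x) (trans e (sym (shift y)))))
  where
  open CommutativeRing K
  open FF K
  open Properties K
  open FiniteField isField using (injective⇒PermOn)
  open TraceConstruction K m k 1≤m isField using (1+1≈0; G; g; G-injective)
  open CharacteristicTwo 1+1≈0 using (x+y≈0⇒x≈y)
  open CharacteristicTwo.Subfield 1+1≈0 m using (q; InSub-Lin; InSub-+; InSub-1)

  G-Lin-injective : ∀ {w} → InSub q w → ¬ (w ≈ 0#) → InjectiveOn (InSub q) (g (Lin m a) w) →
                    Injective _≈_ _≈_ (G (Lin m a) u w)
  G-Lin-injective = G-injective (Lin m a) (Lin-cong m a) (InSub-Lin m a∈) (Lin-zero m a) u∈

  shift : ∀ {s} x → s + (v + 1#) * x ≈ (s + v * x) + x
  shift {s} x = trans (+-congˡ (trans (distribʳ x v 1#) (+-congˡ (*-identityˡ x)))) (sym (+-assoc s _ x))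

  v+1∈ : InSub q (v + 1#)
  v+1∈ = InSub-+ v∈ InSub-1

  v+1≉0 : ¬ (v + 1# ≈ 0#)
  v+1≉0 = v≉1 ∘ x+y≈0⇒x≈y

  g+id-inj : InjectiveOn (InSub q) (λ t → t * Lin m a t + (v + 1#) * t)
  g+id-inj s t s∈ t∈ e = proj₁ (proj₂ g+id-perm) s t s∈ t∈ (trans (sym (shift s)) (trans e (shift t)))
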